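{- $\mathcal A_{11} = \mathcal A_{12} = \mathcal A_{13}$.
   Context: An $\mathcal I$-zroupoid is an algebra $\langle A,\to,0\rangle$ ($\to$ binary, $0$ constant) satisfying $(x \to y) \to z \approx [(z' \to x) \to (y \to z)']'$ and $0''\approx 0$, where $x' := x \to 0$; $\mathcal I$ is the variety of $\mathcal I$-zroupoids. $\mathcal A_{11}, \mathcal A_{12}, \mathcal A_{13}$ are the subvarieties of $\mathcal I$ defined respectively by (A11) $(x \to y) \to z \approx (x \to z) \to y$; (A12) $(x \to y) \to z \approx (y \to x) \to z$; (A13) $(x \to y) \to z \approx (y \to z) \to x$. -}

module Defs where

open import Level using (Level; suc)
open import Relation.Binary.PropositionalEquality using (_≡_)

record Zroupoid (ℓ : Level) : Set (suc ℓ) where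
  field
    Carrier : Set ℓ
    _⇒_     : Carrier → Carrier → Carrier
    𝟎       : Carrier
  infixr 5 _⇒_

  _′ : Carrier → Carrier
  x ′ = x ⇒ 𝟎

IsIZroupoid : ∀ {ℓ} → Zroupoid ℓ → Set ℓ
IsIZroupoid Z =
  (∀ x y z → (x ⇒ y) ⇒ z ≡ (((z ′) ⇒ x) ⇒ ((y ⇒ z) ′)) ′)
  × ((𝟎 ′) ′ ≡ 𝟎)
  where
  open Zroupoid Z
  open import Data.Product using (_×_)

SatA11 : ∀ {ℓ} → Zroupoid ℓ → Set ℓ
SatA11 Z = ∀ x y z → (x ⇒ y) ⇒ z ≡ (x ⇒ z) ⇒ y
  where open Zroupoid Z

SatA12 : ∀ {ℓ} → Zroupoid ℓ → Set ℓ
SatA12 Z = ∀ x y z → (x ⇒ y) ⇒ z ≡ (y ⇒ x) ⇒ z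
  where open Zroupoid Z

SatA13 : ∀ {ℓ} → Zroupoid ℓ → Set ℓ
SatA13 Z = ∀ x y z → (x ⇒ y) ⇒ z ≡ (y ⇒ z) ⇒ x
  where open Zroupoid Z

InA11 InA12 InA13 : ∀ {ℓ} → Zroupoid ℓ → Set ℓ
InA11 Z = IsIZroupoid Z × SatA11 Z where open import Data.Product using (_×_)
InA12 Z = IsIZroupoid Z × SatA12 Z where open import Data.Product using (_×_)
InA13 Z = IsIZroupoid Z × SatA13 Z where open import Data.Product using (_×_)

-- Write x′ for x → 0. All three implications come from rewriting the defining identity
--   (I)  (x → y) → z ≈ ((z′ → x) → (y → z)′)′
-- with the help of the hypothesis until the hypothesis itself exchanges two variables.
-- Under (A11), z′ → x ≈ 0′ → (x → z)′, so (I) becomes ((0′ → (x → z)′) → (y → z)′)′, in which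
-- (A11) swaps (x → z)′ and (y → z)′: this is (A12).
-- Under (A13), (u → v)′ ≈ (0′ → u)′ → v turns (I) into (x → y) → z ≈ (x → z)′′ → (z′ → y),
-- which (A13) and (I) read back as (y → x) → z.
-- Under (A12), (x → y) → z ≈ 0 → ((y → z) → (x → z)), the inner factor z can be dropped, and
-- 0 → ((u → v) → w) ≈ (u → v) → w; hence (x → y) → z ≈ (y → z) → x, which is (A13).
-- Finally (A12) and (A13) together give (A11).

module Submission where

open import Defs
open import Level using (Level)
open import Data.Product using (_×_; _,_; proj₁; proj₂)
open import Function.Bundles using (_⇔_; mk⇔)
open import Relation.Binary.PropositionalEquality using (_≡_; cong; module ≡-Reasoning)

module _ {ℓ : Level} (Z : Zroupoid ℓ) where
  open Zroupoid Z
  open ≡-Reasoning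

  A12∧A13⇒A11 : SatA12 Z → SatA13 Z → SatA11 Z
  A12∧A13⇒A11 a12 a13 x y z = begin
    (x ⇒ y) ⇒ z ≡⟨ a13 x y z ⟩
    (y ⇒ z) ⇒ x ≡⟨ a12 y z x ⟩
    (z ⇒ y) ⇒ x ≡⟨ a13 x z y ⟨
    (x ⇒ z) ⇒ y ∎

  module _ (isI : IsIZroupoid Z) where

    law-I : ∀ x y z → (x ⇒ y) ⇒ z ≡ ((z ′ ⇒ x) ⇒ (y ⇒ z) ′) ′
    law-I = proj₁ isI

    𝟎′′≡𝟎 : 𝟎 ′ ′ ≡ 𝟎
    𝟎′′≡𝟎 = proj₂ isI

    module A11-Properties (a11 : SatA11 Z) where

      [𝟎⇒x]⇒y≡[[𝟎′⇒x]⇒y]′ : ∀ x y → (𝟎 ⇒ x) ⇒ y ≡ ((𝟎 ′ ⇒ x) ⇒ y) ′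
      [𝟎⇒x]⇒y≡[[𝟎′⇒x]⇒y]′ x y = begin
        (𝟎 ⇒ x) ⇒ y
          ≡⟨ cong (λ h → (h ⇒ x) ⇒ y) 𝟎′′≡𝟎 ⟨
        (𝟎 ′ ′ ⇒ x) ⇒ y
          ≡⟨ cong (_⇒ y) (a11 (𝟎 ′) 𝟎 x) ⟩
        (𝟎 ′ ⇒ x) ′ ⇒ y
          ≡⟨ a11 (𝟎 ′ ⇒ x) y 𝟎 ⟨
        ((𝟎 ′ ⇒ x) ⇒ y) ′ ∎

      x′′′≡𝟎⇒x : ∀ x → x ′ ′ ′ ≡ 𝟎 ⇒ x
      x′′′≡𝟎⇒x x = begin
        x ′ ′ ′
          ≡⟨ cong _′ (law-I x 𝟎 𝟎) ⟩
        ((𝟎 ′ ⇒ x) ⇒ 𝟎 ′ ′) ′ ′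
          ≡⟨ cong _′ ([𝟎⇒x]⇒y≡[[𝟎′⇒x]⇒y]′ x (𝟎 ′ ′)) ⟨
        ((𝟎 ⇒ x) ⇒ 𝟎 ′ ′) ′
          ≡⟨ cong _′ (a11 𝟎 x (𝟎 ′ ′)) ⟩
        ((𝟎 ⇒ 𝟎 ′ ′) ⇒ x) ′
          ≡⟨ cong (λ h → ((𝟎 ⇒ h) ⇒ x) ′) 𝟎′′≡𝟎 ⟩
        (𝟎 ′ ⇒ x) ′
          ≡⟨ a11 (𝟎 ′) 𝟎 x ⟨
        𝟎 ′ ′ ⇒ x
          ≡⟨ cong (_⇒ x) 𝟎′′≡𝟎 ⟩
        𝟎 ⇒ x ∎

      𝟎′⇒x′≡𝟎⇒x : ∀ x → 𝟎 ′ ⇒ x ′ ≡ 𝟎 ⇒ x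
      𝟎′⇒x′≡𝟎⇒x x = begin
        𝟎 ′ ⇒ x ′
          ≡⟨ a11 𝟎 𝟎 (x ′) ⟩
        (𝟎 ⇒ x ′) ′
          ≡⟨ cong ((𝟎 ⇒ x ′) ⇒_) 𝟎′′≡𝟎 ⟨
        (𝟎 ⇒ x ′) ⇒ 𝟎 ′ ′
          ≡⟨ [𝟎⇒x]⇒y≡[[𝟎′⇒x]⇒y]′ (x ′) (𝟎 ′ ′) ⟩
        ((𝟎 ′ ⇒ x ′) ⇒ 𝟎 ′ ′) ′
          ≡⟨ law-I (x ′) 𝟎 𝟎 ⟨
        x ′ ′ ′
          ≡⟨ x′′′≡𝟎⇒x x ⟩
        𝟎 ⇒ x ∎

      [𝟎⇒x]′⇒y≡[x′⇒y]′ : ∀ x y → (𝟎 ⇒ x) ′ ⇒ y ≡ (x ′ ⇒ y) ′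
      [𝟎⇒x]′⇒y≡[x′⇒y]′ x y = begin
        (𝟎 ⇒ x) ′ ⇒ y
          ≡⟨ cong (_⇒ y) ([𝟎⇒x]⇒y≡[[𝟎′⇒x]⇒y]′ x 𝟎) ⟩
        (𝟎 ′ ⇒ x) ′ ′ ⇒ y
          ≡⟨ cong (λ h → ((𝟎 ′ ⇒ x) ⇒ h) ′ ⇒ y) 𝟎′′≡𝟎 ⟨
        ((𝟎 ′ ⇒ x) ⇒ 𝟎 ′ ′) ′ ⇒ y
          ≡⟨ cong (_⇒ y) (law-I x 𝟎 𝟎) ⟨
        x ′ ′ ⇒ y
          ≡⟨ a11 (x ′) y 𝟎 ⟨
        (x ′ ⇒ y) ′ ∎

      𝟎⇒x⇒y≡y′⇒x : ∀ x y → 𝟎 ⇒ x ⇒ y ≡ y ′ ⇒ x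
      𝟎⇒x⇒y≡y′⇒x x y = begin
        𝟎 ⇒ x ⇒ y
          ≡⟨ x′′′≡𝟎⇒x (x ⇒ y) ⟨
        (x ⇒ y) ′ ′ ′
          ≡⟨ cong (λ h → h ′ ′) (a11 x y 𝟎) ⟩
        (x ′ ⇒ y) ′ ′
          ≡⟨ cong _′ ([𝟎⇒x]′⇒y≡[x′⇒y]′ x y) ⟨
        ((𝟎 ⇒ x) ′ ⇒ y) ′
          ≡⟨ cong (λ h → (h ⇒ y) ′) (law-I 𝟎 x 𝟎) ⟩
        ((𝟎 ′ ′ ⇒ x ′ ′) ′ ⇒ y) ′
          ≡⟨ cong (λ h → (h ⇒ y) ′) ([𝟎⇒x]⇒y≡[[𝟎′⇒x]⇒y]′ 𝟎 (x ′ ′)) ⟨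
        ((𝟎 ′ ⇒ x ′ ′) ⇒ y) ′
          ≡⟨ cong _′ (a11 (𝟎 ′) y (x ′ ′)) ⟨
        ((𝟎 ′ ⇒ y) ⇒ x ′ ′) ′
          ≡⟨ law-I y x 𝟎 ⟨
        (y ⇒ x) ′
          ≡⟨ a11 y 𝟎 x ⟨
        y ′ ⇒ x ∎

      x′⇒y≡𝟎′⇒[y⇒x]′ : ∀ x y → x ′ ⇒ y ≡ 𝟎 ′ ⇒ (y ⇒ x) ′
      x′⇒y≡𝟎′⇒[y⇒x]′ x y = begin
        x ′ ⇒ y
          ≡⟨ 𝟎⇒x⇒y≡y′⇒x y x ⟨
        𝟎 ⇒ y ⇒ x
          ≡⟨ 𝟎′⇒x′≡𝟎⇒x (y ⇒ x) ⟨
        𝟎 ′ ⇒ (y ⇒ x) ′ ∎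

    A11⇒A12 : SatA11 Z → SatA12 Z
    A11⇒A12 a11 x y z = begin
      (x ⇒ y) ⇒ z
        ≡⟨ law-I x y z ⟩
      ((z ′ ⇒ x) ⇒ (y ⇒ z) ′) ′
        ≡⟨ cong (λ h → (h ⇒ (y ⇒ z) ′) ′) (x′⇒y≡𝟎′⇒[y⇒x]′ z x) ⟩
      ((𝟎 ′ ⇒ (x ⇒ z) ′) ⇒ (y ⇒ z) ′) ′
        ≡⟨ cong _′ (a11 (𝟎 ′) ((x ⇒ z) ′) ((y ⇒ z) ′)) ⟩
      ((𝟎 ′ ⇒ (y ⇒ z) ′) ⇒ (x ⇒ z) ′) ′
        ≡⟨ cong (λ h → (h ⇒ (x ⇒ z) ′) ′) (x′⇒y≡𝟎′⇒[y⇒x]′ z y) ⟨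
      ((z ′ ⇒ y) ⇒ (x ⇒ z) ′) ′
        ≡⟨ law-I y x z ⟨
      (y ⇒ x) ⇒ z ∎
      where open A11-Properties a11

    module A12-Properties (a12 : SatA12 Z) where

      [[[x⇒y]⇒z]⇒u]⇒v≡[u⇒z⇒y⇒x]⇒v : ∀ x y z u v → (((x ⇒ y) ⇒ z) ⇒ u) ⇒ v ≡ (u ⇒ z ⇒ y ⇒ x) ⇒ v
      [[[x⇒y]⇒z]⇒u]⇒v≡[u⇒z⇒y⇒x]⇒v x y z u v = begin
        (((x ⇒ y) ⇒ z) ⇒ u) ⇒ v
          ≡⟨ cong (λ h → (h ⇒ u) ⇒ v) (a12 x y z) ⟩
        (((y ⇒ x) ⇒ z) ⇒ u) ⇒ v
          ≡⟨ cong (_⇒ v) (a12 z (y ⇒ x) u) ⟨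
        ((z ⇒ y ⇒ x) ⇒ u) ⇒ v
          ≡⟨ a12 u (z ⇒ y ⇒ x) v ⟨
        (u ⇒ z ⇒ y ⇒ x) ⇒ v ∎

      [x⇒y]⇒z≡[[z′⇒x]⇒𝟎⇒y⇒z]′ : ∀ x y z → (x ⇒ y) ⇒ z ≡ ((z ′ ⇒ x) ⇒ 𝟎 ⇒ y ⇒ z) ′
      [x⇒y]⇒z≡[[z′⇒x]⇒𝟎⇒y⇒z]′ x y z = begin
        (x ⇒ y) ⇒ z
          ≡⟨ law-I x y z ⟩
        ((z ′ ⇒ x) ⇒ (y ⇒ z) ′) ′
          ≡⟨ a12 (z ′ ⇒ x) ((y ⇒ z) ′) 𝟎 ⟩
        ((y ⇒ z) ′ ⇒ z ′ ⇒ x) ′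
          ≡⟨ cong _′ (a12 𝟎 (y ⇒ z) (z ′ ⇒ x)) ⟨
        ((𝟎 ⇒ y ⇒ z) ⇒ z ′ ⇒ x) ′
          ≡⟨ a12 (z ′ ⇒ x) (𝟎 ⇒ y ⇒ z) 𝟎 ⟨
        ((z ′ ⇒ x) ⇒ 𝟎 ⇒ y ⇒ z) ′ ∎

      [[z⇒y]′⇒z′⇒x]′≡[x⇒y]⇒z : ∀ x y z → ((z ⇒ y) ′ ⇒ z ′ ⇒ x) ′ ≡ (x ⇒ y) ⇒ z
      [[z⇒y]′⇒z′⇒x]′≡[x⇒y]⇒z x y z = begin
        ((z ⇒ y) ′ ⇒ z ′ ⇒ x) ′
          ≡⟨ [[[x⇒y]⇒z]⇒u]⇒v≡[u⇒z⇒y⇒x]⇒v z y 𝟎 (z ′ ⇒ x) 𝟎 ⟩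
        ((z ′ ⇒ x) ⇒ 𝟎 ⇒ y ⇒ z) ′
          ≡⟨ [x⇒y]⇒z≡[[z′⇒x]⇒𝟎⇒y⇒z]′ x y z ⟨
        (x ⇒ y) ⇒ z ∎

      [[𝟎⇒z⇒y]⇒z′⇒x]′≡[x⇒y]⇒z : ∀ x y z → ((𝟎 ⇒ z ⇒ y) ⇒ z ′ ⇒ x) ′ ≡ (x ⇒ y) ⇒ z
      [[𝟎⇒z⇒y]⇒z′⇒x]′≡[x⇒y]⇒z x y z = begin
        ((𝟎 ⇒ z ⇒ y) ⇒ z ′ ⇒ x) ′
          ≡⟨ cong _′ (a12 𝟎 (z ⇒ y) (z ′ ⇒ x)) ⟩
        ((z ⇒ y) ′ ⇒ z ′ ⇒ x) ′
          ≡⟨ [[z⇒y]′⇒z′⇒x]′≡[x⇒y]⇒z x y z ⟩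
        (x ⇒ y) ⇒ z ∎

      [[y⇒x]⇒[x⇒y]′]′≡𝟎⇒x⇒y : ∀ x y → ((y ⇒ x) ⇒ (x ⇒ y) ′) ′ ≡ 𝟎 ⇒ x ⇒ y
      [[y⇒x]⇒[x⇒y]′]′≡𝟎⇒x⇒y x y = begin
        ((y ⇒ x) ⇒ (x ⇒ y) ′) ′
          ≡⟨ cong _′ (a12 x y ((x ⇒ y) ′)) ⟨
        ((x ⇒ y) ⇒ (x ⇒ y) ′) ′
          ≡⟨ a12 ((x ⇒ y) ′) (x ⇒ y) 𝟎 ⟨
        ((x ⇒ y) ′ ⇒ x ⇒ y) ′
          ≡⟨ [x⇒y]⇒z≡[[z′⇒x]⇒𝟎⇒y⇒z]′ ((x ⇒ y) ′) (x ⇒ y) 𝟎 ⟩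
        ((𝟎 ′ ⇒ (x ⇒ y) ′) ⇒ 𝟎 ⇒ (x ⇒ y) ′) ′
          ≡⟨ cong _′ (a12 ((x ⇒ y) ′) (𝟎 ′) (𝟎 ⇒ (x ⇒ y) ′)) ⟨
        (((x ⇒ y) ′ ⇒ 𝟎 ′) ⇒ 𝟎 ⇒ (x ⇒ y) ′) ′
          ≡⟨ a12 ((x ⇒ y) ′ ⇒ 𝟎 ′) (𝟎 ⇒ (x ⇒ y) ′) 𝟎 ⟩
        ((𝟎 ⇒ (x ⇒ y) ′) ⇒ (x ⇒ y) ′ ⇒ 𝟎 ′) ′
          ≡⟨ [[𝟎⇒z⇒y]⇒z′⇒x]′≡[x⇒y]⇒z (𝟎 ′) 𝟎 (x ⇒ y) ⟩
        𝟎 ′ ′ ⇒ x ⇒ y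
          ≡⟨ cong (_⇒ (x ⇒ y)) 𝟎′′≡𝟎 ⟩
        𝟎 ⇒ x ⇒ y ∎

      𝟎⇒x⇒y≡𝟎⇒y⇒x : ∀ x y → 𝟎 ⇒ x ⇒ y ≡ 𝟎 ⇒ y ⇒ x
      𝟎⇒x⇒y≡𝟎⇒y⇒x x y = begin
        𝟎 ⇒ x ⇒ y
          ≡⟨ [[y⇒x]⇒[x⇒y]′]′≡𝟎⇒x⇒y x y ⟨
        ((y ⇒ x) ⇒ (x ⇒ y) ′) ′
          ≡⟨ cong (λ h → ((y ⇒ x) ⇒ h) ′) (a12 x y 𝟎) ⟩
        ((y ⇒ x) ⇒ (y ⇒ x) ′) ′
          ≡⟨ cong _′ (a12 x y ((y ⇒ x) ′)) ⟨
        ((x ⇒ y) ⇒ (y ⇒ x) ′) ′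
          ≡⟨ [[y⇒x]⇒[x⇒y]′]′≡𝟎⇒x⇒y y x ⟩
        𝟎 ⇒ y ⇒ x ∎

      𝟎′⇒x≡𝟎⇒x : ∀ x → 𝟎 ′ ⇒ x ≡ 𝟎 ⇒ x
      𝟎′⇒x≡𝟎⇒x x = begin
        𝟎 ′ ⇒ x
          ≡⟨ cong (λ h → h ′ ⇒ x) 𝟎′′≡𝟎 ⟨
        𝟎 ′ ′ ′ ⇒ x
          ≡⟨ cong (λ h → (𝟎 ′ ⇒ h) ′ ⇒ x) 𝟎′′≡𝟎 ⟨
        (𝟎 ′ ⇒ 𝟎 ′ ′) ′ ⇒ x
          ≡⟨ cong (_⇒ x) ([[y⇒x]⇒[x⇒y]′]′≡𝟎⇒x⇒y 𝟎 𝟎) ⟩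
        (𝟎 ⇒ 𝟎 ′) ⇒ x
          ≡⟨ a12 (𝟎 ′) 𝟎 x ⟨
        𝟎 ′ ′ ⇒ x
          ≡⟨ cong (_⇒ x) 𝟎′′≡𝟎 ⟩
        𝟎 ⇒ x ∎

      𝟎⇒x′≡[x⇒x]′ : ∀ x → 𝟎 ⇒ x ′ ≡ (x ⇒ x) ′
      𝟎⇒x′≡[x⇒x]′ x = begin
        𝟎 ⇒ x ′
          ≡⟨ [[y⇒x]⇒[x⇒y]′]′≡𝟎⇒x⇒y x 𝟎 ⟨
        ((𝟎 ⇒ x) ⇒ x ′ ′) ′
          ≡⟨ cong (λ h → (h ⇒ x ′ ′) ′) (𝟎′⇒x≡𝟎⇒x x) ⟨
        ((𝟎 ′ ⇒ x) ⇒ x ′ ′) ′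
          ≡⟨ law-I x x 𝟎 ⟨
        (x ⇒ x) ′ ∎

      𝟎⇒𝟎⇒𝟎⇒x′≡𝟎⇒x : ∀ x → 𝟎 ⇒ 𝟎 ⇒ 𝟎 ⇒ x ′ ≡ 𝟎 ⇒ x
      𝟎⇒𝟎⇒𝟎⇒x′≡𝟎⇒x x = begin
        𝟎 ⇒ 𝟎 ⇒ 𝟎 ⇒ x ′
          ≡⟨ 𝟎⇒x⇒y≡𝟎⇒y⇒x 𝟎 (𝟎 ⇒ x ′) ⟩
        𝟎 ⇒ (𝟎 ⇒ x ′) ′
          ≡⟨ cong (𝟎 ⇒_) (a12 𝟎 (x ′) 𝟎) ⟩
        𝟎 ⇒ x ′ ′ ′
          ≡⟨ 𝟎⇒x′≡[x⇒x]′ (x ′ ′) ⟩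
        (x ′ ′ ⇒ x ′ ′) ′
          ≡⟨ [[z⇒y]′⇒z′⇒x]′≡[x⇒y]⇒z 𝟎 𝟎 x ⟩
        𝟎 ′ ⇒ x
          ≡⟨ 𝟎′⇒x≡𝟎⇒x x ⟩
        𝟎 ⇒ x ∎

      [[𝟎⇒y]⇒𝟎⇒x]′≡[x⇒y]′ : ∀ x y → ((𝟎 ⇒ y) ⇒ 𝟎 ⇒ x) ′ ≡ (x ⇒ y) ′
      [[𝟎⇒y]⇒𝟎⇒x]′≡[x⇒y]′ x y = begin
        ((𝟎 ⇒ y) ⇒ 𝟎 ⇒ x) ′
          ≡⟨ cong (λ h → (h ⇒ 𝟎 ⇒ x) ′) (𝟎⇒𝟎⇒𝟎⇒x′≡𝟎⇒x y) ⟨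
        ((𝟎 ⇒ 𝟎 ⇒ 𝟎 ⇒ y ′) ⇒ 𝟎 ⇒ x) ′
          ≡⟨ cong _′ (a12 (𝟎 ⇒ 𝟎 ⇒ y ′) 𝟎 (𝟎 ⇒ x)) ⟨
        ((𝟎 ⇒ 𝟎 ⇒ y ′) ′ ⇒ 𝟎 ⇒ x) ′
          ≡⟨ cong (λ h → ((h ⇒ 𝟎 ⇒ y ′) ′ ⇒ 𝟎 ⇒ x) ′) 𝟎′′≡𝟎 ⟨
        ((𝟎 ′ ′ ⇒ 𝟎 ⇒ y ′) ′ ⇒ 𝟎 ⇒ x) ′
          ≡⟨ cong (λ h → (h ⇒ 𝟎 ⇒ x) ′) ([x⇒y]⇒z≡[[z′⇒x]⇒𝟎⇒y⇒z]′ 𝟎 y 𝟎) ⟨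
        ((𝟎 ⇒ y) ′ ⇒ 𝟎 ⇒ x) ′
          ≡⟨ cong _′ (a12 (𝟎 ⇒ y) 𝟎 (𝟎 ⇒ x)) ⟩
        ((𝟎 ⇒ 𝟎 ⇒ y) ⇒ 𝟎 ⇒ x) ′
          ≡⟨ cong (λ h → ((𝟎 ⇒ 𝟎 ⇒ y) ⇒ h) ′) (𝟎′⇒x≡𝟎⇒x x) ⟨
        ((𝟎 ⇒ 𝟎 ⇒ y) ⇒ 𝟎 ′ ⇒ x) ′
          ≡⟨ [[𝟎⇒z⇒y]⇒z′⇒x]′≡[x⇒y]⇒z x y 𝟎 ⟩
        (x ⇒ y) ′ ∎

      [x⇒y]′≡[x⇒y′]′ : ∀ x y → (x ⇒ y) ′ ≡ (x ⇒ y ′) ′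
      [x⇒y]′≡[x⇒y′]′ x y = begin
        (x ⇒ y) ′
          ≡⟨ [x⇒y]⇒z≡[[z′⇒x]⇒𝟎⇒y⇒z]′ x y 𝟎 ⟩
        ((𝟎 ′ ⇒ x) ⇒ 𝟎 ⇒ y ′) ′
          ≡⟨ cong (λ h → (h ⇒ 𝟎 ⇒ y ′) ′) (𝟎′⇒x≡𝟎⇒x x) ⟩
        ((𝟎 ⇒ x) ⇒ 𝟎 ⇒ y ′) ′
          ≡⟨ [[𝟎⇒y]⇒𝟎⇒x]′≡[x⇒y]′ (y ′) x ⟩
        (y ′ ⇒ x) ′
          ≡⟨ a12 x (y ′) 𝟎 ⟨
        (x ⇒ y ′) ′ ∎

      𝟎⇒x⇒y≡𝟎⇒x⇒y⇒x : ∀ x y → 𝟎 ⇒ x ⇒ y ≡ 𝟎 ⇒ x ⇒ y ⇒ x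
      𝟎⇒x⇒y≡𝟎⇒x⇒y⇒x x y = begin
        𝟎 ⇒ x ⇒ y
          ≡⟨ 𝟎⇒𝟎⇒𝟎⇒x′≡𝟎⇒x (x ⇒ y) ⟨
        𝟎 ⇒ 𝟎 ⇒ 𝟎 ⇒ (x ⇒ y) ′
          ≡⟨ cong (λ h → 𝟎 ⇒ 𝟎 ⇒ 𝟎 ⇒ h) ([x⇒y]′≡[x⇒y′]′ x y) ⟩
        𝟎 ⇒ 𝟎 ⇒ 𝟎 ⇒ (x ⇒ y ′) ′
          ≡⟨ 𝟎⇒𝟎⇒𝟎⇒x′≡𝟎⇒x (x ⇒ y ′) ⟩
        𝟎 ⇒ x ⇒ y ′
          ≡⟨ 𝟎⇒x⇒y≡𝟎⇒y⇒x x (y ′) ⟩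
        𝟎 ⇒ y ′ ⇒ x
          ≡⟨ cong (𝟎 ⇒_) ([[𝟎⇒z⇒y]⇒z′⇒x]′≡[x⇒y]⇒z y 𝟎 x) ⟨
        𝟎 ⇒ ((𝟎 ⇒ x ′) ⇒ x ′ ⇒ y) ′
          ≡⟨ cong (λ h → 𝟎 ⇒ (h ⇒ x ′ ⇒ y) ′) (𝟎⇒x′≡[x⇒x]′ x) ⟩
        𝟎 ⇒ ((x ⇒ x) ′ ⇒ x ′ ⇒ y) ′
          ≡⟨ cong (𝟎 ⇒_) ([[z⇒y]′⇒z′⇒x]′≡[x⇒y]⇒z y x x) ⟩
        𝟎 ⇒ (y ⇒ x) ⇒ x
          ≡⟨ 𝟎⇒x⇒y≡𝟎⇒y⇒x x (y ⇒ x) ⟨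
        𝟎 ⇒ x ⇒ y ⇒ x ∎

      [𝟎⇒x]⇒x≡𝟎⇒x : ∀ x → (𝟎 ⇒ x) ⇒ x ≡ 𝟎 ⇒ x
      [𝟎⇒x]⇒x≡𝟎⇒x x = begin
        (𝟎 ⇒ x) ⇒ x
          ≡⟨ [[z⇒y]′⇒z′⇒x]′≡[x⇒y]⇒z 𝟎 x x ⟨
        ((x ⇒ x) ′ ⇒ x ′ ′) ′
          ≡⟨ cong (λ h → (h ⇒ x ′ ′) ′) (𝟎⇒x′≡[x⇒x]′ x) ⟨
        ((𝟎 ⇒ x ′) ⇒ x ′ ′) ′
          ≡⟨ [[𝟎⇒z⇒y]⇒z′⇒x]′≡[x⇒y]⇒z 𝟎 𝟎 x ⟩
        𝟎 ′ ⇒ x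
          ≡⟨ 𝟎′⇒x≡𝟎⇒x x ⟩
        𝟎 ⇒ x ∎

      𝟎⇒x⇒y≡y′⇒x : ∀ x y → 𝟎 ⇒ x ⇒ y ≡ y ′ ⇒ x
      𝟎⇒x⇒y≡y′⇒x x y = begin
        𝟎 ⇒ x ⇒ y
          ≡⟨ [[y⇒x]⇒[x⇒y]′]′≡𝟎⇒x⇒y x y ⟨
        ((y ⇒ x) ⇒ (x ⇒ y) ′) ′
          ≡⟨ cong (λ h → ((y ⇒ x) ⇒ h) ′) ([[𝟎⇒y]⇒𝟎⇒x]′≡[x⇒y]′ x y) ⟨
        ((y ⇒ x) ⇒ ((𝟎 ⇒ y) ⇒ 𝟎 ⇒ x) ′) ′
          ≡⟨ [x⇒y]′≡[x⇒y′]′ (y ⇒ x) ((𝟎 ⇒ y) ⇒ 𝟎 ⇒ x) ⟨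
        ((y ⇒ x) ⇒ (𝟎 ⇒ y) ⇒ 𝟎 ⇒ x) ′
          ≡⟨ [[[x⇒y]⇒z]⇒u]⇒v≡[u⇒z⇒y⇒x]⇒v x 𝟎 (𝟎 ⇒ y) (y ⇒ x) 𝟎 ⟨
        ((x ′ ⇒ 𝟎 ⇒ y) ⇒ y ⇒ x) ′
          ≡⟨ [x⇒y]′≡[x⇒y′]′ (x ′ ⇒ 𝟎 ⇒ y) (y ⇒ x) ⟩
        ((x ′ ⇒ 𝟎 ⇒ y) ⇒ (y ⇒ x) ′) ′
          ≡⟨ law-I (𝟎 ⇒ y) y x ⟨
        ((𝟎 ⇒ y) ⇒ y) ⇒ x
          ≡⟨ cong (_⇒ x) ([𝟎⇒x]⇒x≡𝟎⇒x y) ⟩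
        (𝟎 ⇒ y) ⇒ x
          ≡⟨ a12 y 𝟎 x ⟨
        y ′ ⇒ x ∎

      [[z′⇒x]⇒y⇒z]′≡[x⇒y]⇒z : ∀ x y z → ((z ′ ⇒ x) ⇒ y ⇒ z) ′ ≡ (x ⇒ y) ⇒ z
      [[z′⇒x]⇒y⇒z]′≡[x⇒y]⇒z x y z = begin
        ((z ′ ⇒ x) ⇒ y ⇒ z) ′
          ≡⟨ [x⇒y]′≡[x⇒y′]′ (z ′ ⇒ x) (y ⇒ z) ⟩
        ((z ′ ⇒ x) ⇒ (y ⇒ z) ′) ′
          ≡⟨ law-I x y z ⟨
        (x ⇒ y) ⇒ z ∎

      𝟎⇒[y⇒z]⇒x⇒z≡[x⇒y]⇒z : ∀ x y z → 𝟎 ⇒ (y ⇒ z) ⇒ x ⇒ z ≡ (x ⇒ y) ⇒ z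
      𝟎⇒[y⇒z]⇒x⇒z≡[x⇒y]⇒z x y z = begin
        𝟎 ⇒ (y ⇒ z) ⇒ x ⇒ z
          ≡⟨ cong (𝟎 ⇒_) ([[z′⇒x]⇒y⇒z]′≡[x⇒y]⇒z y z (x ⇒ z)) ⟨
        𝟎 ⇒ (((x ⇒ z) ′ ⇒ y) ⇒ z ⇒ x ⇒ z) ′
          ≡⟨ 𝟎⇒x⇒y≡𝟎⇒y⇒x (((x ⇒ z) ′ ⇒ y) ⇒ z ⇒ x ⇒ z) 𝟎 ⟩
        𝟎 ⇒ 𝟎 ⇒ ((x ⇒ z) ′ ⇒ y) ⇒ z ⇒ x ⇒ z
          ≡⟨ 𝟎⇒x⇒y≡y′⇒x 𝟎 (((x ⇒ z) ′ ⇒ y) ⇒ z ⇒ x ⇒ z) ⟩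
        (((x ⇒ z) ′ ⇒ y) ⇒ z ⇒ x ⇒ z) ′ ′
          ≡⟨ cong _′ ([[z′⇒x]⇒y⇒z]′≡[x⇒y]⇒z y z (x ⇒ z)) ⟩
        ((y ⇒ z) ⇒ x ⇒ z) ′
          ≡⟨ [[𝟎⇒y]⇒𝟎⇒x]′≡[x⇒y]′ (y ⇒ z) (x ⇒ z) ⟨
        ((𝟎 ⇒ x ⇒ z) ⇒ 𝟎 ⇒ y ⇒ z) ′
          ≡⟨ cong (λ h → (h ⇒ 𝟎 ⇒ y ⇒ z) ′) (𝟎⇒x⇒y≡y′⇒x x z) ⟩
        ((z ′ ⇒ x) ⇒ 𝟎 ⇒ y ⇒ z) ′
          ≡⟨ [x⇒y]⇒z≡[[z′⇒x]⇒𝟎⇒y⇒z]′ x y z ⟨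
        (x ⇒ y) ⇒ z ∎

      𝟎⇒[x⇒y]⇒z≡[x⇒y]⇒z : ∀ x y z → 𝟎 ⇒ (x ⇒ y) ⇒ z ≡ (x ⇒ y) ⇒ z
      𝟎⇒[x⇒y]⇒z≡[x⇒y]⇒z x y z = begin
        𝟎 ⇒ (x ⇒ y) ⇒ z
          ≡⟨ cong (𝟎 ⇒_) (𝟎⇒[y⇒z]⇒x⇒z≡[x⇒y]⇒z x y z) ⟨
        𝟎 ⇒ 𝟎 ⇒ (y ⇒ z) ⇒ x ⇒ z
          ≡⟨ 𝟎⇒x⇒y≡𝟎⇒y⇒x 𝟎 ((y ⇒ z) ⇒ x ⇒ z) ⟩
        𝟎 ⇒ ((y ⇒ z) ⇒ x ⇒ z) ′
          ≡⟨ 𝟎⇒x⇒y≡y′⇒x ((y ⇒ z) ⇒ x ⇒ z) 𝟎 ⟩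
        𝟎 ′ ⇒ (y ⇒ z) ⇒ x ⇒ z
          ≡⟨ 𝟎′⇒x≡𝟎⇒x ((y ⇒ z) ⇒ x ⇒ z) ⟩
        𝟎 ⇒ (y ⇒ z) ⇒ x ⇒ z
          ≡⟨ 𝟎⇒[y⇒z]⇒x⇒z≡[x⇒y]⇒z x y z ⟩
        (x ⇒ y) ⇒ z ∎

      𝟎⇒[y⇒z]⇒x⇒z≡𝟎⇒[y⇒z]⇒x : ∀ x y z → 𝟎 ⇒ (y ⇒ z) ⇒ x ⇒ z ≡ 𝟎 ⇒ (y ⇒ z) ⇒ x
      𝟎⇒[y⇒z]⇒x⇒z≡𝟎⇒[y⇒z]⇒x x y z = begin
        𝟎 ⇒ (y ⇒ z) ⇒ x ⇒ z
          ≡⟨ 𝟎⇒x⇒y≡𝟎⇒y⇒x (y ⇒ z) (x ⇒ z) ⟩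
        𝟎 ⇒ (x ⇒ z) ⇒ y ⇒ z
          ≡⟨ 𝟎⇒[x⇒y]⇒z≡[x⇒y]⇒z x z (y ⇒ z) ⟩
        (x ⇒ z) ⇒ y ⇒ z
          ≡⟨ [x⇒y]⇒z≡[[z′⇒x]⇒𝟎⇒y⇒z]′ x z (y ⇒ z) ⟩
        (((y ⇒ z) ′ ⇒ x) ⇒ 𝟎 ⇒ z ⇒ y ⇒ z) ′
          ≡⟨ cong (λ h → (((y ⇒ z) ′ ⇒ x) ⇒ h) ′) (𝟎⇒x⇒y≡𝟎⇒x⇒y⇒x z y) ⟨
        (((y ⇒ z) ′ ⇒ x) ⇒ 𝟎 ⇒ z ⇒ y) ′
          ≡⟨ cong (λ h → (((y ⇒ z) ′ ⇒ x) ⇒ h) ′) (𝟎⇒x⇒y≡𝟎⇒y⇒x y z) ⟨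
        (((y ⇒ z) ′ ⇒ x) ⇒ 𝟎 ⇒ y ⇒ z) ′
          ≡⟨ [[z′⇒x]⇒y⇒z]′≡[x⇒y]⇒z x 𝟎 (y ⇒ z) ⟩
        x ′ ⇒ y ⇒ z
          ≡⟨ 𝟎⇒x⇒y≡y′⇒x (y ⇒ z) x ⟨
        𝟎 ⇒ (y ⇒ z) ⇒ x ∎

    A12⇒A13 : SatA12 Z → SatA13 Z
    A12⇒A13 a12 x y z = begin
      (x ⇒ y) ⇒ z
        ≡⟨ 𝟎⇒[y⇒z]⇒x⇒z≡[x⇒y]⇒z x y z ⟨
      𝟎 ⇒ (y ⇒ z) ⇒ x ⇒ z
        ≡⟨ 𝟎⇒[y⇒z]⇒x⇒z≡𝟎⇒[y⇒z]⇒x x y z ⟩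
      𝟎 ⇒ (y ⇒ z) ⇒ x
        ≡⟨ 𝟎⇒[x⇒y]⇒z≡[x⇒y]⇒z y z x ⟩
      (y ⇒ z) ⇒ x ∎
      where open A12-Properties a12

    A12⇒A11 : SatA12 Z → SatA11 Z
    A12⇒A11 a12 = A12∧A13⇒A11 a12 (A12⇒A13 a12)

    module A13-Properties (a13 : SatA13 Z) where

      [[x⇒y]⇒z]⇒u≡[y⇒u]⇒z⇒x : ∀ x y z u → ((x ⇒ y) ⇒ z) ⇒ u ≡ (y ⇒ u) ⇒ z ⇒ x
      [[x⇒y]⇒z]⇒u≡[y⇒u]⇒z⇒x x y z u = begin
        ((x ⇒ y) ⇒ z) ⇒ u
          ≡⟨ cong (_⇒ u) (a13 z x y) ⟨
        ((z ⇒ x) ⇒ y) ⇒ u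
          ≡⟨ a13 (z ⇒ x) y u ⟩
        (y ⇒ u) ⇒ z ⇒ x ∎

      [x⇒y]′≡[𝟎′⇒x]′⇒y : ∀ x y → (x ⇒ y) ′ ≡ (𝟎 ′ ⇒ x) ′ ⇒ y
      [x⇒y]′≡[𝟎′⇒x]′⇒y x y = begin
        (x ⇒ y) ′
          ≡⟨ cong ((x ⇒ y) ⇒_) 𝟎′′≡𝟎 ⟨
        (x ⇒ y) ⇒ 𝟎 ′ ′
          ≡⟨ cong (λ h → (x ⇒ y) ⇒ h ′ ′) 𝟎′′≡𝟎 ⟨
        (x ⇒ y) ⇒ 𝟎 ′ ′ ′ ′
          ≡⟨ cong (λ h → (x ⇒ y) ⇒ h ′) (a13 (𝟎 ′) 𝟎 𝟎) ⟩
        (x ⇒ y) ⇒ (𝟎 ′ ⇒ 𝟎 ′) ′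
          ≡⟨ cong ((x ⇒ y) ⇒_) (a13 (𝟎 ′) (𝟎 ′) 𝟎) ⟩
        (x ⇒ y) ⇒ 𝟎 ′ ′ ⇒ 𝟎 ′
          ≡⟨ cong (λ h → (x ⇒ y) ⇒ h ⇒ 𝟎 ′) 𝟎′′≡𝟎 ⟩
        (x ⇒ y) ⇒ 𝟎 ⇒ 𝟎 ′
          ≡⟨ [[x⇒y]⇒z]⇒u≡[y⇒u]⇒z⇒x (𝟎 ′) x 𝟎 y ⟨
        (𝟎 ′ ⇒ x) ′ ⇒ y ∎

    A13⇒A12 : SatA13 Z → SatA12 Z
    A13⇒A12 a13 x y z = begin
      (x ⇒ y) ⇒ z
        ≡⟨ law-I x y z ⟩
      ((z ′ ⇒ x) ⇒ (y ⇒ z) ′) ′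
        ≡⟨ [x⇒y]′≡[𝟎′⇒x]′⇒y (z ′ ⇒ x) ((y ⇒ z) ′) ⟩
      (𝟎 ′ ⇒ z ′ ⇒ x) ′ ⇒ (y ⇒ z) ′
        ≡⟨ cong (λ h → (𝟎 ′ ⇒ h) ′ ⇒ (y ⇒ z) ′) (a13 x z 𝟎) ⟨
      (𝟎 ′ ⇒ (x ⇒ z) ′) ′ ⇒ (y ⇒ z) ′
        ≡⟨ cong ((𝟎 ′ ⇒ (x ⇒ z) ′) ′ ⇒_) (a13 y z 𝟎) ⟩
      (𝟎 ′ ⇒ (x ⇒ z) ′) ′ ⇒ z ′ ⇒ y
        ≡⟨ cong (λ h → h ′ ⇒ z ′ ⇒ y) ([[x⇒y]⇒z]⇒u≡[y⇒u]⇒z⇒x 𝟎 𝟎 (x ⇒ z) 𝟎) ⟨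
      (𝟎 ′ ⇒ x ⇒ z) ′ ′ ⇒ z ′ ⇒ y
        ≡⟨ cong (_⇒ (z ′ ⇒ y)) ([x⇒y]′≡[𝟎′⇒x]′⇒y (x ⇒ z) 𝟎) ⟨
      (x ⇒ z) ′ ′ ⇒ z ′ ⇒ y
        ≡⟨ a13 (z ′ ⇒ y) ((x ⇒ z) ′) 𝟎 ⟨
      ((z ′ ⇒ y) ⇒ (x ⇒ z) ′) ′
        ≡⟨ law-I y x z ⟨
      (y ⇒ x) ⇒ z ∎
      where open A13-Properties a13

theorem3p14 : ∀ {ℓ : Level} (Z : Zroupoid ℓ) →
    (InA11 Z ⇔ InA12 Z) × (InA12 Z ⇔ InA13 Z)
theorem3p14 Z =
  mk⇔ (λ (i , a11) → i , A11⇒A12 Z i a11) (λ (i , a12) → i , A12⇒A11 Z i a12) ,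
  mk⇔ (λ (i , a12) → i , A12⇒A13 Z i a12) (λ (i , a13) → i , A13⇒A12 Z i a13)
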